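{- Let $G$ be a unigraph (a finite simple graph such that every graph with the same degree sequence is isomorphic to $G$), and let $G=(G_k,A_k,B_k)\circ\cdots\circ(G_1,A_1,B_1)\circ G_0$ be its canonical decomposition. Then $$\mathrm{cw}(G)\le \max\Big\{4,\ \max_{i\in\{1,\dots,k\}} \mathrm{scw}(G_i,A_i,B_i),\ \mathrm{cw}(G_0)\Big\},$$ where terms over an empty index set or for an empty $G_0$ are omitted.
   Context: Clique-width: $\mathrm{cw}(G)$ is the minimum number $k$ of labels from $\{1,\dots,k\}$ needed to construct $G$ using the operations: $v(i)$ (create a new vertex $v$ with label $i$), $\oplus$ (disjoint union), $\eta_{i,j}$ with $i\ne j$ (add all edges between vertices labeled $i$ and vertices labeled $j$), and $\rho_{i\to j}$ (relabel every vertex of label $i$ to label $j$). A splitted graph is a triple $(G,A,B)$ where $G$ is a graph and $V(G)=A\cup B$ is a partition with $A$ a clique and $B$ an independent set. The split clique-width $\mathrm{scw}(G,A,B)$ is the minimum number of labels needed to construct $G$ with the same four operations such that at the end every vertex of $A$ has label $1$ and every vertex of $B$ has label $2$. For a splitted graph $(G,A,B)$ and a graph $H$ with disjoint vertex set, the composition $(G,A,B)\circ H$ is the graph with vertex set $A\cup B\cup V(H)$ and edge set $E(G)\cup E(H)\cup\{\{a,v\}: a\in A, v\in V(H)\}$; the composition of two splitted graphs $(G_1,A_1,B_1)\circ(G_2,A_2,B_2)$ is regarded as the splitted graph with clique $A_1\cup A_2$ and independent set $B_1\cup B_2$, and $\circ$ is associative. A graph is decomposable if it can be written as $(G,A,B)\circ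 H$ with both parts nonempty, and indecomposable otherwise. By Tyshkevich's decomposition theorem, every graph $G$ can be uniquely written as $G=(G_k,A_k,B_k)\circ\cdots\circ(G_1,A_1,B_1)\circ G_0$ where each $(G_i,A_i,B_i)$ is an indecomposable splitted (split) graph and $G_0$ is an indecomposable nonsplit graph or empty; this is the canonical decomposition of $G$. -}

module Defs where

open import Data.Nat using (ℕ; zero; suc; _+_; _≤_; _⊔_)
open import Data.Fin using (Fin; toℕ; splitAt; _≟_)
open import Data.Bool using (Bool; true; false; if_then_else_; _∨_; _∧_; not)
open import Data.Sum using (_⊎_; inj₁; inj₂)
open import Data.Product using (Σ; _×_; _,_; proj₁; proj₂; ∃)
open import Data.List using (List; []; _∷_; map; allFin; foldr)
open import Data.Nat.ListAction using (sum)
open import Data.List.Relation.Binary.Permutation.Propositional using (_↭_)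
open import Data.List.Relation.Binary.Pointwise using (Pointwise)
open import Relation.Binary.PropositionalEquality using (_≡_; _≢_)
open import Relation.Nullary using (¬_)
open import Relation.Nullary.Decidable using (⌊_⌋)
open import Function.Definitions using (Bijective)

Adj : ℕ → Set
Adj n = Fin n → Fin n → Bool

record Graph (n : ℕ) : Set where
  field
    adj    : Adj n
    sym    : ∀ u v → adj u v ≡ adj v u
    irrefl : ∀ v → adj v v ≡ false
open Graph public

Iso : ∀ {m n} → Adj m → Adj n → Set
Iso {m} {n} A B = Σ (Fin m → Fin n) λ f →
  Bijective _≡_ _≡_ f × (∀ u v → A u v ≡ B (f u) (f v))

deg : ∀ {n} → Graph n → Fin n → ℕ
deg {n} G v = sum (map (λ u → if adj G v u then 1 else 0) (allFin n))

degSeq : ∀ {n} → Graph n → List ℕ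
degSeq {n} G = map (deg G) (allFin n)

-- unigraph: every graph with the same degree sequence is isomorphic to G
-- (graphs with the same degree sequence have the same number of vertices)
Unigraph : ∀ {n} → Graph n → Set
Unigraph {n} G = ∀ (H : Graph n) → degSeq H ↭ degSeq G → Iso (adj H) (adj G)

-- Split partitions, splitted graphs (inA v = true  iff  v ∈ A, else v ∈ B)

IsSplitPartition : ∀ {n} → Adj n → (Fin n → Bool) → Set
IsSplitPartition {n} A inA =
  (∀ u v → u ≢ v → inA u ≡ true → inA v ≡ true → A u v ≡ true) ×
  (∀ u v → inA u ≡ false → inA v ≡ false → A u v ≡ false)

IsSplitGraph : ∀ {n} → Adj n → Set
IsSplitGraph {n} A = Σ (Fin n → Bool) (IsSplitPartition A)

record SplitG (n : ℕ) : Set where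
  field
    graph : Graph n
    inA   : Fin n → Bool
    split : IsSplitPartition (adj graph) inA
open SplitG public

-- composition (G,A,B) ∘ H : vertices of S come first, then those of H
compose : ∀ {a b} → SplitG a → Adj b → Adj (a + b)
compose {a} S H x y with splitAt a x | splitAt a y
... | inj₁ u | inj₁ v = adj (graph S) u v
... | inj₂ u | inj₂ v = H u v
... | inj₁ u | inj₂ v = inA S u
... | inj₂ u | inj₁ v = inA S v

Decomposable : ∀ {n} → Graph n → Set
Decomposable {n} G = Σ ℕ λ a → Σ ℕ λ b → 1 ≤ a × 1 ≤ b ×
  Σ (SplitG a) λ S → Σ (Graph b) λ H → Iso (compose S (adj H)) (adj G)

Indecomposable : ∀ {n} → Graph n → Set
Indecomposable G = ¬ Decomposable G

-- Decompositions  (S_k ∘ ... ∘ S_1) ∘ G0, list head = S_k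

SplitComp : Set
SplitComp = Σ ℕ SplitG

total : List SplitComp → ℕ → ℕ
total []             m = m
total ((a , _) ∷ Ss) m = a + total Ss m

composeAll : ∀ {m} (Ss : List SplitComp) → Adj m → Adj (total Ss m)
composeAll []             H = H
composeAll ((a , S) ∷ Ss) H = compose S (composeAll Ss H)

GoodComp : SplitComp → Set
GoodComp (a , S) = 1 ≤ a × Indecomposable (graph S)

data AllComps (P : SplitComp → Set) : List SplitComp → Set where
  []  : AllComps P []
  _∷_ : ∀ {S Ss} → P S → AllComps P Ss → AllComps P (S ∷ Ss)

-- canonical decomposition of G (unique by Tyshkevich's theorem):
-- every S_i an indecomposable splitted graph, G0 empty or indecomposable nonsplit
IsCanonicalDecomposition : ∀ {n m} → Graph n → List SplitComp → Graph m → Set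
IsCanonicalDecomposition {n} {m} G Ss G0 =
  AllComps GoodComp Ss ×
  (m ≡ 0 ⊎ (Indecomposable G0 × ¬ IsSplitGraph (adj G0))) ×
  Iso (composeAll Ss (adj G0)) (adj G)

-- k-expressions (labels Fin k ≅ {1,…,k}), indexed by number of vertices

data Expr (k : ℕ) : ℕ → Set where
  vtx : Fin k → Expr k 1
  _⊕_ : ∀ {a b} → Expr k a → Expr k b → Expr k (a + b)
  η   : ∀ {n} (i j : Fin k) → i ≢ j → Expr k n → Expr k n
  ρ   : ∀ {n} (i j : Fin k) → Expr k n → Expr k n

record LGraph (k n : ℕ) : Set where
  constructor lgraph
  field
    lab  : Fin n → Fin k
    ladj : Adj n
open LGraph public

⟦_⟧ : ∀ {k n} → Expr k n → LGraph k n
⟦ vtx i ⟧ = lgraph (λ _ → i) (λ _ _ → false)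
⟦ _⊕_ {a} e₁ e₂ ⟧ = lgraph lab' adj'
  where
  L₁ = ⟦ e₁ ⟧
  L₂ = ⟦ e₂ ⟧
  lab' : Fin _ → Fin _
  lab' x with splitAt a x
  ... | inj₁ u = lab L₁ u
  ... | inj₂ u = lab L₂ u
  adj' : Adj _
  adj' x y with splitAt a x | splitAt a y
  ... | inj₁ u | inj₁ v = ladj L₁ u v
  ... | inj₂ u | inj₂ v = ladj L₂ u v
  ... | inj₁ _ | inj₂ _ = false
  ... | inj₂ _ | inj₁ _ = false
⟦ η i j _ e ⟧ = lgraph (lab L) (λ x y → ladj L x y
      ∨ (⌊ lab L x ≟ i ⌋ ∧ ⌊ lab L y ≟ j ⌋)
      ∨ (⌊ lab L x ≟ j ⌋ ∧ ⌊ lab L y ≟ i ⌋))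
  where L = ⟦ e ⟧
⟦ ρ i j e ⟧ = lgraph (λ x → if ⌊ lab L x ≟ i ⌋ then j else lab L x) (ladj L)
  where L = ⟦ e ⟧

CWle : ∀ {n} → Graph n → ℕ → Set
CWle {n} G k = Σ (Expr k n) λ e → Iso (ladj ⟦ e ⟧) (adj G)

-- (G,A,B) can be constructed with k labels, ending with A labelled 1, B labelled 2
-- (label 1 = toℕ 0, label 2 = toℕ 1)
SCWle : ∀ {n} → SplitG n → ℕ → Set
SCWle {n} S k = Σ (Expr k n) λ e → Σ (Iso (ladj ⟦ e ⟧) (adj (graph S))) λ f →
  ∀ x → toℕ (lab ⟦ e ⟧ x) ≡ (if inA S (proj₁ f x) then 0 else 1)

IsCW : ∀ {n} → Graph n → ℕ → Set
IsCW G c = CWle G c × (∀ k → CWle G k → c ≤ k)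

IsSCW : ∀ {n} → SplitG n → ℕ → Set
IsSCW S c = SCWle S c × (∀ k → SCWle S k → c ≤ k)

maxList : List ℕ → ℕ
maxList = foldr _⊔_ 0

module Submission where

-- Writing
-- G ≅ S_k ∘ ⋯ ∘ S_1 ∘ G0, let K = max(4, scw(S_i), cw(G0)) ≥ 3 and
-- reserve label 1 for clique vertices, label 2 for independent vertices
-- and label 3 as a "finished" label.  By induction on the decomposition
-- we build K-expressions for S_i ∘ ⋯ ∘ S_1 ∘ G0 in which every vertex
-- carries label 3:
--   * for G0: its cw-expression, with all labels finally renamed to 3;
--   * for S ∘ H: take the scw-expression of S (clique 1, independent 2)
--     beside the expression of H (all 3), join labels 1 and 3 with η,
--     and rename all labels to 3 again.

open import Defs
open import Data.Nat using (ℕ; _≤_; _⊔_; _+_; z≤n; s≤s)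
open import Data.Nat.Properties using (≤-trans; m≤m⊔n; m≤n⊔m; m⊔n≤o⇒m≤o; m⊔n≤o⇒n≤o)
open import Data.Product using (_×_; _,_; proj₁; proj₂)
open import Data.Sum using (_⊎_; inj₁; inj₂; [_,_]′)
import Data.Sum as Sum
open import Data.List using (List; []; _∷_; allFin)
open import Data.List.Relation.Binary.Pointwise using (Pointwise; []; _∷_)
import Data.List.Relation.Binary.Pointwise as Pointwise
open import Data.List.Membership.Propositional using (_∈_)
open import Data.List.Membership.Propositional.Properties using (∈-allFin)
open import Data.List.Relation.Unary.Any using (here; there)
open import Data.Fin using (Fin; zero; suc; toℕ; splitAt; join; _≟_; inject≤; _↑ˡ_; _↑ʳ_)
open import Data.Fin.Properties
  using (toℕ-inject≤; inject≤-injective; splitAt-↑ˡ; splitAt-↑ʳ; splitAt⁻¹-↑ˡ; +↔⊎; cantor-schröder-bernstein)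
open import Data.Sum.Function.Propositional using (_⊎-↔_)
open import Data.Bool using (Bool; true; false; if_then_else_; _∨_; _∧_)
open import Data.Bool.Properties using (∨-identityʳ)
open import Data.Empty using (⊥; ⊥-elim)
open import Function using (id; _∘_)
open import Function.Bundles using (Inverse; Bijection; _↔_; mk↔ₛ′; mk⤖)
open import Function.Definitions using (Injective)
open import Function.Properties.Bijection using (⤖⇒↔)
open import Function.Properties.Inverse using (↔-trans; ↔-sym; ↔⇒⤖)
open import Relation.Binary.PropositionalEquality using (_≡_; refl; trans; cong; cong₂)
  renaming (sym to ≡-sym)
open import Relation.Nullary using (yes; no)
open import Relation.Nullary.Decidable using (⌊_⌋)

open Inverse using (to; from; strictlyInverseˡ)

-- Isomorphisms of adjacency structures, carrying an explicit inverse of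
-- the vertex bijection so that they compose and invert easily.
record _≅_ {m n} (A : Adj m) (B : Adj n) : Set where
  field
    vertices  : Fin m ↔ Fin n
    preserves : ∀ u v → A u v ≡ B (to vertices u) (to vertices v)
open _≅_

fromIso : ∀ {m n} {A : Adj m} {B : Adj n} → Iso A B → A ≅ B
fromIso (f , bij , pres) = record { vertices = ⤖⇒↔ (mk⤖ bij) ; preserves = pres }

toIso : ∀ {m n} {A : Adj m} {B : Adj n} → A ≅ B → Iso A B
toIso i = to (vertices i) , Bijection.bijective (↔⇒⤖ (vertices i)) , preserves i

≅-trans : ∀ {m n p} {A : Adj m} {B : Adj n} {C : Adj p} → A ≅ B → B ≅ C → A ≅ C
≅-trans i j = record
  { vertices  = ↔-trans (vertices i) (vertices j)
  ; preserves = λ u v → trans (preserves i u v) (preserves j _ _) }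

≅-sym : ∀ {m n} {A : Adj m} {B : Adj n} → A ≅ B → B ≅ A
≅-sym {A = A} {B = B} i = record { vertices = ↔-sym (vertices i) ; preserves = pres }
  where
  pres : ∀ u v → B u v ≡ A (from (vertices i) u) (from (vertices i) v)
  pres u v = trans (cong₂ B (≡-sym (invˡ u)) (≡-sym (invˡ v))) (≡-sym (preserves i _ _))
    where invˡ = strictlyInverseˡ (vertices i)

≅-respˡ : ∀ {m n} {A A' : Adj m} {B : Adj n} → (∀ x y → A x y ≡ A' x y) → A' ≅ B → A ≅ B
≅-respˡ A≡A' i = record
  { vertices = vertices i ; preserves = λ u v → trans (A≡A' u v) (preserves i u v) }

≅-size : ∀ {m n} {A : Adj m} {B : Adj n} → A ≅ B → m ≡ n
≅-size i = cantor-schröder-bernstein (Bijection.injective (↔⇒⤖ (vertices i)))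
                                    (Bijection.injective (↔⇒⤖ (↔-sym (vertices i))))

someVertex : ∀ {k n} → Expr k n → Fin n
someVertex (vtx _)                = zero
someVertex (_⊕_ {b = b} e₁ _)     = someVertex e₁ ↑ˡ b
someVertex (η _ _ _ e)            = someVertex e
someVertex (ρ _ _ e)              = someVertex e

⌊≟⌋-injective : ∀ {k K} {σ : Fin k → Fin K} → Injective _≡_ _≡_ σ →
                ∀ a b → ⌊ σ a ≟ σ b ⌋ ≡ ⌊ a ≟ b ⌋
⌊≟⌋-injective {σ = σ} σ-inj a b with a ≟ b | σ a ≟ σ b
... | yes _   | yes _     = refl
... | yes a≡b | no σa≢σb  = ⊥-elim (σa≢σb (cong σ a≡b))
... | no a≢b  | yes σa≡σb = ⊥-elim (a≢b (σ-inj σa≡σb))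
... | no _    | no _      = refl

module Rename {k K} (σ : Fin k → Fin K) (σ-inj : Injective _≡_ _≡_ σ) where

  rename : ∀ {n} → Expr k n → Expr K n
  rename (vtx i)      = vtx (σ i)
  rename (e₁ ⊕ e₂)    = rename e₁ ⊕ rename e₂
  rename (η i j i≢j e) = η (σ i) (σ j) (i≢j ∘ σ-inj) (rename e)
  rename (ρ i j e)    = ρ (σ i) (σ j) (rename e)

  relabel-σ : ∀ a i j → (if ⌊ σ a ≟ σ i ⌋ then σ j else σ a) ≡ σ (if ⌊ a ≟ i ⌋ then j else a)
  relabel-σ a i j rewrite ⌊≟⌋-injective σ-inj a i with ⌊ a ≟ i ⌋
  ... | true  = refl
  ... | false = refl

  rename-lab : ∀ {n} (e : Expr k n) x → lab ⟦ rename e ⟧ x ≡ σ (lab ⟦ e ⟧ x)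
  rename-lab (vtx i)              x = refl
  rename-lab (_⊕_ {a} e₁ e₂)      x with splitAt a x
  ... | inj₁ u = rename-lab e₁ u
  ... | inj₂ u = rename-lab e₂ u
  rename-lab (η i j i≢j e)        x = rename-lab e x
  rename-lab (ρ i j e)            x rewrite rename-lab e x = relabel-σ (lab ⟦ e ⟧ x) i j

  rename-adj : ∀ {n} (e : Expr k n) x y → ladj ⟦ rename e ⟧ x y ≡ ladj ⟦ e ⟧ x y
  rename-adj (vtx i)         x y = refl
  rename-adj (_⊕_ {a} e₁ e₂) x y with splitAt a x | splitAt a y
  ... | inj₁ u | inj₁ v = rename-adj e₁ u v
  ... | inj₂ u | inj₂ v = rename-adj e₂ u v
  ... | inj₁ u | inj₂ v = refl
  ... | inj₂ u | inj₁ v = refl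
  rename-adj (η i j i≢j e)   x y
    rewrite rename-adj e x y | rename-lab e x | rename-lab e y
          | ⌊≟⌋-injective σ-inj (lab ⟦ e ⟧ x) i | ⌊≟⌋-injective σ-inj (lab ⟦ e ⟧ y) j
          | ⌊≟⌋-injective σ-inj (lab ⟦ e ⟧ x) j | ⌊≟⌋-injective σ-inj (lab ⟦ e ⟧ y) i = refl
  rename-adj (ρ i j e)       x y = rename-adj e x y

widen : ∀ {k K n} → k ≤ K → Expr k n → Expr K n
widen k≤K = Rename.rename (λ i → inject≤ i k≤K) (inject≤-injective k≤K k≤K _ _)

widen-adj : ∀ {k K n} (k≤K : k ≤ K) (e : Expr k n) x y → ladj ⟦ widen k≤K e ⟧ x y ≡ ladj ⟦ e ⟧ x y
widen-adj k≤K = Rename.rename-adj (λ i → inject≤ i k≤K) (inject≤-injective k≤K k≤K _ _)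

widen-lab : ∀ {k K n} (k≤K : k ≤ K) (e : Expr k n) x → toℕ (lab ⟦ widen k≤K e ⟧ x) ≡ toℕ (lab ⟦ e ⟧ x)
widen-lab k≤K e x = trans (cong toℕ (Rename.rename-lab (λ i → inject≤ i k≤K) (inject≤-injective k≤K k≤K _ _) e x))
                          (toℕ-inject≤ _ k≤K)

module Collapse {K} (z : Fin K) where

  relabelAll : ∀ {n} → List (Fin K) → Expr K n → Expr K n
  relabelAll []       e = e
  relabelAll (i ∷ is) e = relabelAll is (ρ i z e)

  relabelAll-adj : ∀ {n} is (e : Expr K n) x y → ladj ⟦ relabelAll is e ⟧ x y ≡ ladj ⟦ e ⟧ x y
  relabelAll-adj []       e x y = refl
  relabelAll-adj (i ∷ is) e x y = relabelAll-adj is (ρ i z e) x y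

  ρ-pending : ∀ a i is → a ≡ z ⊎ a ∈ i ∷ is →
              let a' = if ⌊ a ≟ i ⌋ then z else a in a' ≡ z ⊎ a' ∈ is
  ρ-pending a i is pending with a ≟ i
  ... | yes _ = inj₁ refl
  ρ-pending a i is (inj₁ a≡z)          | no _   = inj₁ a≡z
  ρ-pending a i is (inj₂ (here a≡i))   | no a≢i = ⊥-elim (a≢i a≡i)
  ρ-pending a i is (inj₂ (there a∈is)) | no _   = inj₂ a∈is

  relabelAll-lab : ∀ {n} is (e : Expr K n) x → lab ⟦ e ⟧ x ≡ z ⊎ lab ⟦ e ⟧ x ∈ is →
                   lab ⟦ relabelAll is e ⟧ x ≡ z
  relabelAll-lab []       e x (inj₁ eq) = eq
  relabelAll-lab (i ∷ is) e x pending   = relabelAll-lab is (ρ i z e) x (ρ-pending _ i is pending)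

  collapse : ∀ {n} → Expr K n → Expr K n
  collapse = relabelAll (allFin K)

  collapse-adj : ∀ {n} (e : Expr K n) x y → ladj ⟦ collapse e ⟧ x y ≡ ladj ⟦ e ⟧ x y
  collapse-adj = relabelAll-adj (allFin K)

  collapse-lab : ∀ {n} (e : Expr K n) x → lab ⟦ collapse e ⟧ x ≡ z
  collapse-lab e x = relabelAll-lab (allFin K) e x (inj₂ (∈-allFin _))

module ComposeBlocks {a b} (S : SplitG a) (H : Adj b) where

  compose-SS : ∀ u v → compose S H (u ↑ˡ b) (v ↑ˡ b) ≡ adj (graph S) u v
  compose-SS u v rewrite splitAt-↑ˡ a u b | splitAt-↑ˡ a v b = refl

  compose-HH : ∀ u v → compose S H (a ↑ʳ u) (a ↑ʳ v) ≡ H u v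
  compose-HH u v rewrite splitAt-↑ʳ a b u | splitAt-↑ʳ a b v = refl

  compose-SH : ∀ u v → compose S H (u ↑ˡ b) (a ↑ʳ v) ≡ inA S u
  compose-SH u v rewrite splitAt-↑ˡ a u b | splitAt-↑ʳ a b v = refl

  compose-HS : ∀ u v → compose S H (a ↑ʳ u) (v ↑ˡ b) ≡ inA S v
  compose-HS u v rewrite splitAt-↑ʳ a b u | splitAt-↑ˡ a v b = refl

  compose-empty : (Fin b → ⊥) → compose S H ≅ adj (graph S)
  compose-empty noVertex = record
    { vertices  = mk↔ₛ′ dropH (_↑ˡ b) dropH-↑ˡ ↑ˡ-dropH ; preserves = preserves-dropH }
    where
    dropH : Fin (a + b) → Fin a
    dropH x = [ id , ⊥-elim ∘ noVertex ]′ (splitAt a x)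

    dropH-↑ˡ : ∀ u → dropH (u ↑ˡ b) ≡ u
    dropH-↑ˡ u rewrite splitAt-↑ˡ a u b = refl

    ↑ˡ-dropH : ∀ x → dropH x ↑ˡ b ≡ x
    ↑ˡ-dropH x with splitAt a x in eq
    ... | inj₁ u = splitAt⁻¹-↑ˡ eq
    ... | inj₂ v = ⊥-elim (noVertex v)

    preserves-dropH : ∀ x y → compose S H x y ≡ adj (graph S) (dropH x) (dropH y)
    preserves-dropH x y with splitAt a x | splitAt a y
    ... | inj₁ u | inj₁ v = refl
    ... | inj₂ u | _      = ⊥-elim (noVertex u)
    ... | inj₁ u | inj₂ v = ⊥-elim (noVertex v)

module Construction (K' : ℕ) where

  Label : Set
  Label = Fin (3 + K')

  cliqueLabel independentLabel doneLabel : Label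
  cliqueLabel      = zero
  independentLabel = suc zero
  doneLabel        = suc (suc zero)

  sideLabel : Bool → Label
  sideLabel true  = cliqueLabel
  sideLabel false = independentLabel

  sideLabel-toℕ : ∀ (p : Label) c → toℕ p ≡ (if c then 0 else 1) → p ≡ sideLabel c
  sideLabel-toℕ zero          true  _ = refl
  sideLabel-toℕ (suc zero)    false _ = refl
  sideLabel-toℕ zero          false ()
  sideLabel-toℕ (suc zero)    true  ()
  sideLabel-toℕ (suc (suc _)) true  ()
  sideLabel-toℕ (suc (suc _)) false ()

  record SplitExpr {a} (S : SplitG a) : Set where
    field
      expr  : Expr (3 + K') a
      iso   : ladj ⟦ expr ⟧ ≅ adj (graph S)
      sides : ∀ x → lab ⟦ expr ⟧ x ≡ sideLabel (inA S (to (vertices iso) x))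

  -- An expression in which every vertex carries label 3.  Its number of
  -- vertices is only propositionally that of T (see ≅-size).
  record DoneExpr {n} (T : Adj n) : Set where
    field
      {size} : ℕ
      expr : Expr (3 + K') size
      iso  : ladj ⟦ expr ⟧ ≅ T
      done : ∀ x → lab ⟦ expr ⟧ x ≡ doneLabel

  Buildable : ∀ {n} → Adj n → Set
  Buildable {n} T = (Fin n → ⊥) ⊎ DoneExpr T

  open Collapse doneLabel

  finish : ∀ {n N} {T : Adj N} (e : Expr (3 + K') n) → ladj ⟦ e ⟧ ≅ T → DoneExpr T
  finish e e≅T = record
    { expr = collapse e ; iso = ≅-respˡ (collapse-adj e) e≅T ; done = collapse-lab e }

  splitExpr : ∀ {a s} {S : SplitG a} → SCWle S s → s ≤ 3 + K' → SplitExpr S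
  splitExpr {S = S} (e , e≅S , labelled) s≤K = record
    { expr  = widen s≤K e
    ; iso   = ≅-respˡ (widen-adj s≤K e) (fromIso e≅S)
    ; sides = λ x → sideLabel-toℕ _ (inA S (proj₁ e≅S x)) (trans (widen-lab s≤K e x) (labelled x)) }

  doneExpr : ∀ {m c} {G : Graph m} → CWle G c → c ≤ 3 + K' → DoneExpr (adj G)
  doneExpr (e , e≅G) c≤K = finish (widen c≤K e) (≅-respˡ (widen-adj c≤K e) (fromIso e≅G))

  ηEdge : Label → Label → Bool
  ηEdge p q = (⌊ p ≟ cliqueLabel ⌋ ∧ ⌊ q ≟ doneLabel ⌋) ∨ (⌊ p ≟ doneLabel ⌋ ∧ ⌊ q ≟ cliqueLabel ⌋)

  ηEdge-SS : ∀ c d → ηEdge (sideLabel c) (sideLabel d) ≡ false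
  ηEdge-SS true  true  = refl
  ηEdge-SS true  false = refl
  ηEdge-SS false true  = refl
  ηEdge-SS false false = refl

  ηEdge-HH : ηEdge doneLabel doneLabel ≡ false
  ηEdge-HH = refl

  ηEdge-SH : ∀ c → ηEdge (sideLabel c) doneLabel ≡ c
  ηEdge-SH true  = refl
  ηEdge-SH false = refl

  ηEdge-HS : ∀ c → ηEdge doneLabel (sideLabel c) ≡ c
  ηEdge-HS true  = refl
  ηEdge-HS false = refl

  module Join {a b} {S : SplitG a} {H : Adj b} (eS : SplitExpr S) (eH : DoneExpr H) where
    open SplitExpr eS renaming (expr to sExpr; iso to sIso)
    open DoneExpr eH renaming (size to h; expr to hExpr; iso to hIso)
    open ComposeBlocks S H

    joinExpr : Expr (3 + K') (a + h)
    joinExpr = η cliqueLabel doneLabel (λ ()) (sExpr ⊕ hExpr)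

    fS : Fin a → Fin a
    fS = to (vertices sIso)

    fH : Fin h → Fin b
    fH = to (vertices hIso)

    side : Fin a → Bool
    side u = inA S (fS u)

    join≅ : ladj ⟦ joinExpr ⟧ ≅ compose S H
    join≅ = record
      { vertices  = ↔-trans +↔⊎ (↔-trans (vertices sIso ⊎-↔ vertices hIso) (↔-sym +↔⊎))
      ; preserves = preserves-join }
      where
      preserves-join : ∀ x y → ladj ⟦ joinExpr ⟧ x y ≡ compose S H (join a b (Sum.map fS fH (splitAt a x)))
                                                                      (join a b (Sum.map fS fH (splitAt a y)))
      preserves-join x y with splitAt a x | splitAt a y
      ... | inj₁ u | inj₁ v =
        trans (cong₂ (λ p q → ladj ⟦ sExpr ⟧ u v ∨ ηEdge p q) (sides u) (sides v))
        (trans (cong (ladj ⟦ sExpr ⟧ u v ∨_) (ηEdge-SS (side u) (side v)))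
        (trans (∨-identityʳ _)
        (trans (preserves sIso u v) (≡-sym (compose-SS (fS u) (fS v))))))
      ... | inj₂ u | inj₂ v =
        trans (cong₂ (λ p q → ladj ⟦ hExpr ⟧ u v ∨ ηEdge p q) (done u) (done v))
        (trans (cong (ladj ⟦ hExpr ⟧ u v ∨_) ηEdge-HH)
        (trans (∨-identityʳ _)
        (trans (preserves hIso u v) (≡-sym (compose-HH (fH u) (fH v))))))
      ... | inj₁ u | inj₂ v =
        trans (cong₂ ηEdge (sides u) (done v))
        (trans (ηEdge-SH (side u)) (≡-sym (compose-SH (fS u) (fH v))))
      ... | inj₂ u | inj₁ v =
        trans (cong₂ ηEdge (done u) (sides v))
        (trans (ηEdge-HS (side v)) (≡-sym (compose-HS (fH u) (fS v))))

  composeStep : ∀ {a b} {S : SplitG a} {H : Adj b} → SplitExpr S → Buildable H → Buildable (compose S H)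
  composeStep {S = S} {H} eS (inj₁ noVertex) =
    inj₂ (finish (SplitExpr.expr eS) (≅-trans (SplitExpr.iso eS) (≅-sym (ComposeBlocks.compose-empty S H noVertex))))
  composeStep eS (inj₂ eH) = inj₂ (finish (Join.joinExpr eS eH) (Join.join≅ eS eH))

  composeAllStep : ∀ {m} {G0 : Adj m} → Buildable G0 → (Ss : List SplitComp) (ss : List ℕ) →
                   Pointwise (λ S s → SCWle (proj₂ S) s) Ss ss → maxList ss ≤ 3 + K' →
                   Buildable (composeAll Ss G0)
  composeAllStep built []       []       []           _     = built
  composeAllStep built (_ ∷ Ss) (s ∷ ss) (scw ∷ scws) max≤K =
    composeStep (splitExpr scw (m⊔n≤o⇒m≤o s _ max≤K))
                (composeAllStep built Ss ss scws (m⊔n≤o⇒n≤o s _ max≤K))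

  -- A buildable graph isomorphic to a graph with some expression (hence
  -- nonempty) has an expression with 3 + K' labels.
  realise : ∀ {n N c} {T : Adj N} {G : Graph n} → Buildable T → T ≅ adj G → CWle G c → CWle G (3 + K')
  realise (inj₁ noVertex) T≅G (e , _) = ⊥-elim (noVertex (from (vertices T≅G) (someVertex e)))
  realise (inj₂ eT) T≅G _ with ≅-size (≅-trans (DoneExpr.iso eT) T≅G)
  ... | refl = DoneExpr.expr eT , toIso (≅-trans (DoneExpr.iso eT) T≅G)

cw-composeAll : ∀ {n m K c c0} → 3 ≤ K → (G : Graph n) (Ss : List SplitComp) (G0 : Graph m) →
                Iso (composeAll Ss (adj G0)) (adj G) → CWle G c →
                (ss : List ℕ) → Pointwise (λ S s → SCWle (proj₂ S) s) Ss ss → maxList ss ≤ K →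
                (m ≡ 0 ⊎ CWle G0 c0) → c0 ≤ K → CWle G K
cw-composeAll {m = m} {c0 = c0} (s≤s (s≤s (s≤s {n = K'} _))) G Ss G0 G≅ cwG ss scws max≤K cw0 c0≤K =
  realise {G = G} (composeAllStep (base cw0) Ss ss scws max≤K) (fromIso G≅) cwG
  where
  open Construction K'
  base : m ≡ 0 ⊎ CWle G0 c0 → Buildable (adj G0)
  base (inj₁ refl) = inj₁ λ ()
  base (inj₂ cw)   = inj₂ (doneExpr {G = G0} cw c0≤K)

lemma2 : ∀ {n m} (G : Graph n) → Unigraph G →
         (Ss : List SplitComp) (G0 : Graph m) → IsCanonicalDecomposition G Ss G0 →
         (c : ℕ) → IsCW G c →
         (ss : List ℕ) → Pointwise (λ S s → IsSCW (proj₂ S) s) Ss ss →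
         (c0 : ℕ) → ((m ≡ 0 × c0 ≡ 0) ⊎ IsCW G0 c0) →
         c ≤ 4 ⊔ maxList ss ⊔ c0
lemma2 G _ Ss G0 (_ , _ , G≅) c (cwG , minimal) ss scws c0 cw0 =
  minimal K (cw-composeAll 3≤K G Ss G0 G≅ cwG ss (Pointwise.map proj₁ scws) maxss≤K
                           (Sum.map proj₁ proj₁ cw0) c0≤K)
  where
  K = 4 ⊔ maxList ss ⊔ c0

  3≤K : 3 ≤ K
  3≤K = ≤-trans (s≤s (s≤s (s≤s z≤n))) (≤-trans (m≤m⊔n 4 (maxList ss)) (m≤m⊔n _ c0))

  maxss≤K : maxList ss ≤ K
  maxss≤K = ≤-trans (m≤n⊔m 4 (maxList ss)) (m≤m⊔n _ c0)

  c0≤K : c0 ≤ K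
  c0≤K = m≤n⊔m _ c0
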